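{- Let $K$ be an imaginary quadratic field and let $W$ be the set of Weil generators for $K$. Then $\#\{\alpha \in W : h(\alpha) \leq N\} = 4N + O(1)$ as $N\to\infty$.
   Context: For a CM field $K$ with complex conjugation $\alpha\mapsto\overline{\alpha}$, an element $\alpha \in \mathcal{O}_K$ is a Weil generator for $K$ if $\alpha\overline{\alpha} \in \mathbb{Z}$ and $\mathbb{Z}[\alpha,\overline{\alpha}] = \mathcal{O}_K$. The height of an algebraic number $\alpha$ is $h(\alpha) = \max_{\sigma:\mathbb{Q}(\alpha)\to\mathbb{C}} |\sigma(\alpha)|$.
   Formalization: The height bound N ranges over the rationals. -}

module Defs where

open import Data.Nat as ℕ using (ℕ; zero; suc)
open import Data.Nat.Divisibility using (_∣_)
open import Data.Integer as ℤ using (ℤ; +_)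
open import Data.Rational as ℚ using (ℚ; _/_; 0ℚ; 1ℚ)
open import Data.Product using (Σ; _×_; _,_; proj₁; proj₂)
open import Data.List using (List; []; _∷_)
open import Relation.Binary.PropositionalEquality using (_≡_)

SquareFree : ℕ → Set
SquareFree d = ∀ m → (m ℕ.* m) ∣ d → m ≡ 1

-- Every imaginary quadratic field is K_d = ℚ(√-d) for a unique squarefree d ≥ 1.
-- An element of K_d is a pair (x , y) of rationals standing for x + y √-d.
-- (ℚ of the standard library is normalised, so ≡ is the field equality.)
K : Set
K = ℚ × ℚ

ℤ→ℚ : ℤ → ℚ
ℤ→ℚ z = z / 1

module QuadField (d : ℕ) where

  dℚ : ℚ
  dℚ = ℤ→ℚ (+ d)

  _+K_ : K → K → K
  (x , y) +K (x' , y') = (x ℚ.+ x') , (y ℚ.+ y')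

  _*K_ : K → K → K
  (x , y) *K (x' , y') = (x ℚ.* x' ℚ.- dℚ ℚ.* (y ℚ.* y')) , (x ℚ.* y' ℚ.+ y ℚ.* x')

  fromℤK : ℤ → K
  fromℤK z = ℤ→ℚ z , 0ℚ

  _^K_ : K → ℕ → K
  a ^K zero = fromℤK (+ 1)
  a ^K suc n = a *K (a ^K n)

  conj : K → K
  conj (x , y) = x , ℚ.- y

  trace : K → ℚ
  trace (x , y) = x ℚ.+ x

  norm : K → ℚ
  norm (x , y) = x ℚ.* x ℚ.+ dℚ ℚ.* (y ℚ.* y)

  IsInteger : ℚ → Set
  IsInteger q = Σ ℤ λ z → q ≡ ℤ→ℚ z

  -- α ∈ 𝒪_K : α is a root of the monic polynomial t² - Tr(α) t + N(α),
  -- which has integer coefficients (it is the characteristic polynomial of α).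
  InO : K → Set
  InO α = IsInteger (trace α) × IsInteger (norm α)

  -- integer polynomials in two variables: lists of terms c · X^i · Y^j
  Poly2 : Set
  Poly2 = List (ℤ × ℕ × ℕ)

  eval2 : Poly2 → K → K → K
  eval2 [] a b = fromℤK (+ 0)
  eval2 ((c , i , j) ∷ ps) a b =
    ((fromℤK c *K (a ^K i)) *K (b ^K j)) +K eval2 ps a b

  InZAlphaAlphaBar : K → K → Set
  InZAlphaAlphaBar α β = Σ Poly2 λ P → eval2 P α (conj α) ≡ β

  -- Weil generator: α ∈ 𝒪_K, αᾱ ∈ ℤ, and ℤ[α, ᾱ] = 𝒪_K
  -- (ℤ[α, ᾱ] ⊆ 𝒪_K is automatic from α ∈ 𝒪_K, but is included for the equality).
  IsWeilGenerator : K → Set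
  IsWeilGenerator α =
    InO α
    × IsInteger (proj₁ (α *K conj α))
    × proj₂ (α *K conj α) ≡ 0ℚ
    × (∀ β → InO β → InZAlphaAlphaBar α β)
    × (∀ β → InZAlphaAlphaBar α β → InO β)

  -- h(α) ≤ N.  The two complex embeddings send x + y√-d to x ± y i√d, both of
  -- absolute value √(x² + d y²); so h(α) ≤ N iff N ≥ 0 and x² + d y² ≤ N².
  HeightLe : K → ℚ → Set
  HeightLe α N = (0ℚ ℚ.≤ N) × (norm α ℚ.≤ N ℚ.* N)

module Submission where

-- For integral α one has ᾱ = Tr α − α and α² = Tr α · α − N α, so ℤ[α, ᾱ] = ℤ + ℤα. Hence, if
-- {1, ω} is an integral basis of 𝒪_K (ω = √-d, or ω = (1 + √-d)/2 when d ≡ 3 mod 4), α is a Weil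
-- generator iff ℤ + ℤα = ℤ + ℤω, i.e. iff α = c ± ω with c ∈ ℤ. Writing ω = (e/2, y), these are the
-- points (m/2, ±y) with m ≡ e mod 2, of squared height m²/4 + d y². Those of height ≤ N are the ones
-- with |m| ≤ B for the largest admissible B ≡ e mod 2; there are 2(B + 1) of them, and for N ≥ d + 1
-- one has B/2 ≤ N < B/2 + 3/2, so their number differs from 4N by at most 4.

open import Defs
open import Data.Nat as ℕ using (ℕ; zero; suc; _≥_; _≤_; _<_; z≤n; s≤s; NonZero)
import Data.Nat.Properties as ℕP
open import Data.Nat.Divisibility using (_∣_; divides; *-cancelʳ-∣; ∣-trans; m∣m*n; m%n≡0⇒n∣m)
open import Data.Nat.DivMod using (_%_; m≡m%n+[m/n]*n; m%n<n; [m+kn]%n≡m%n; m*n%n≡0)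
import Data.Nat.Coprimality as Coprime
open Coprime using (Coprime; coprime-divisor)
import Data.Nat.Tactic.RingSolver as ℕ-Solver
open import Data.Integer as ℤ using (ℤ; +_; -[1+_]; +[1+_])
import Data.Integer.Properties as ℤP
import Data.Integer.Tactic.RingSolver as ℤ-Solver
open import Data.Rational as ℚ using (ℚ; mkℚ; _/_; 0ℚ; 1ℚ; ½)
import Data.Rational.Properties as ℚP
import Data.Rational.Unnormalised as ℚᵘ
import Data.Rational.Unnormalised.Properties as ℚᵘP
open import Data.Product using (Σ; _×_; _,_; proj₁; proj₂)
open import Data.Sum using (_⊎_; inj₁; inj₂; [_,_]′)
import Data.Sum as Sum
open import Data.Empty using (⊥-elim)
open import Data.Maybe using (Maybe; just; nothing)
open import Data.List using (List; []; _∷_; _++_; map; length)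
import Data.List.Properties as List
open import Data.List.Membership.Propositional using (_∈_)
open import Data.List.Membership.Propositional.Properties using (∈-map⁺; ∈-map⁻; ∈-++⁺ˡ; ∈-++⁺ʳ; ∈-++⁻)
open import Data.List.Relation.Unary.Any using (here; there)
import Data.List.Relation.Unary.All as All
import Data.List.Relation.Unary.AllPairs as AllPairs
open import Data.List.Relation.Unary.Unique.Propositional using (Unique)
import Data.List.Relation.Unary.Unique.Propositional.Properties as Unique
open import Function.Bundles using (_⇔_; mk⇔; Equivalence)
import Function.Properties.Equivalence as ⇔
open import Relation.Binary.PropositionalEquality
open import Relation.Nullary using (¬_; yes; no)
open import Relation.Unary using (Decidable)
open import Tactic.RingSolver using (solve-∀; solve)
open import Tactic.RingSolver.Core.AlmostCommutativeRing using (AlmostCommutativeRing; fromCommutativeRing)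

open Defs using () renaming (ℤ→ℚ to ι)

ℚ-ring : AlmostCommutativeRing _ _
ℚ-ring = fromCommutativeRing ℚP.+-*-commutativeRing isZero
  where
  isZero : (p : ℚ) → Maybe (0ℚ ≡ p)
  isZero p with 0ℚ ℚP.≟ p
  ... | yes 0≡p = just 0≡p
  ... | no _    = nothing

coprimeTo-1 : ∀ n → Coprime.Coprime n 1
coprimeTo-1 n = Coprime.sym (Coprime.1-coprimeTo n)

ι≡mkℚ : ∀ z → ι z ≡ mkℚ z 0 (coprimeTo-1 ℤ.∣ z ∣)
ι≡mkℚ (+ n)    = ℚP.normalize-coprime (coprimeTo-1 n)
ι≡mkℚ -[1+ n ] = cong ℚ.-_ (ℚP.normalize-coprime (coprimeTo-1 (suc n)))

ι-homo-+ : ∀ a b → ι (a ℤ.+ b) ≡ ι a ℚ.+ ι b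
ι-homo-+ a b rewrite ι≡mkℚ a | ι≡mkℚ b =
  cong (ℚ._/ 1) (cong₂ ℤ._+_ (sym (ℤP.*-identityʳ a)) (sym (ℤP.*-identityʳ b)))

ι-homo-* : ∀ a b → ι (a ℤ.* b) ≡ ι a ℚ.* ι b
ι-homo-* a b rewrite ι≡mkℚ a | ι≡mkℚ b = refl

ι-homo-neg : ∀ a → ι (ℤ.- a) ≡ ℚ.- ι a
ι-homo-neg a rewrite ι≡mkℚ (ℤ.- a) | ι≡mkℚ a = neg-mkℚ a
  where
  neg-mkℚ : ∀ a → mkℚ (ℤ.- a) 0 (coprimeTo-1 ℤ.∣ ℤ.- a ∣) ≡ ℚ.- mkℚ a 0 (coprimeTo-1 ℤ.∣ a ∣)
  neg-mkℚ (+ zero) = refl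
  neg-mkℚ +[1+ n ] = refl
  neg-mkℚ -[1+ n ] = refl

ι-injective : ∀ {a b} → ι a ≡ ι b → a ≡ b
ι-injective {a} {b} eq rewrite ι≡mkℚ a | ι≡mkℚ b = proj₁ (ℚP.mkℚ-injective eq)

i*j≡1⇒j≡±1 : ∀ {w v} → w ℤ.* v ≡ + 1 → v ≡ + 1 ⊎ v ≡ ℤ.- + 1
i*j≡1⇒j≡±1 {w} {v} wv≡1 = ∣∣≡1 v (ℕP.m*n≡1⇒n≡1 ℤ.∣ w ∣ ℤ.∣ v ∣ (trans (sym (ℤP.abs-* w v)) (cong ℤ.∣_∣ wv≡1)))
  where
  ∣∣≡1 : ∀ v → ℤ.∣ v ∣ ≡ 1 → v ≡ + 1 ⊎ v ≡ ℤ.- + 1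
  ∣∣≡1 +[1+ 0 ] _ = inj₁ refl
  ∣∣≡1 -[1+ 0 ] _ = inj₂ refl
  ∣∣≡1 (+ 0) ()
  ∣∣≡1 +[1+ suc _ ] ()
  ∣∣≡1 -[1+ suc _ ] ()

p*q≡q⇒p≡1 : ∀ {r b} → b ≢ 0ℚ → r ℚ.* b ≡ b → r ≡ 1ℚ
p*q≡q⇒p≡1 {r} {b} b≢0 rb≡b = begin
  r                      ≡⟨ ℚP.*-identityʳ r ⟨
  r ℚ.* 1ℚ               ≡⟨ cong (r ℚ.*_) (ℚP.*-inverseʳ b) ⟨
  r ℚ.* (b ℚ.* 1/b)      ≡⟨ ℚP.*-assoc r b 1/b ⟨
  (r ℚ.* b) ℚ.* 1/b      ≡⟨ cong (ℚ._* 1/b) rb≡b ⟩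
  b ℚ.* 1/b              ≡⟨ ℚP.*-inverseʳ b ⟩
  1ℚ                     ∎
  where
  open ≡-Reasoning
  instance _ = ℚ.≢-nonZero b≢0
  1/b = ℚ.1/ b

halve : ∀ {p σ a} → p ℚ.+ p ≡ ι (+ σ ℤ.+ + 2 ℤ.* a) → p ≡ ι a ℚ.+ ι (+ σ) ℚ.* ½
halve {p} {σ} {a} 2p≡ = begin
  p                                         ≡⟨ solve (p ∷ []) ℚ-ring ⟩
  (p ℚ.+ p) ℚ.* ½                           ≡⟨ cong (ℚ._* ½) 2p≡ ⟩
  ι (+ σ ℤ.+ + 2 ℤ.* a) ℚ.* ½               ≡⟨ cong (ℚ._* ½) (trans (ι-homo-+ (+ σ) (+ 2 ℤ.* a)) (cong (ι (+ σ) ℚ.+_) (ι-homo-* (+ 2) a))) ⟩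
  (ι (+ σ) ℚ.+ ι (+ 2) ℚ.* ι a) ℚ.* ½       ≡⟨ distribute-½ (ι (+ σ)) (ι a) ⟩
  ι a ℚ.+ ι (+ σ) ℚ.* ½                     ∎
  where
  open ≡-Reasoning
  distribute-½ : ∀ S A → (S ℚ.+ ι (+ 2) ℚ.* A) ℚ.* ½ ≡ A ℚ.+ S ℚ.* ½
  distribute-½ = solve-∀ ℚ-ring

ι-mono-≤ : ∀ {a b} → a ℤ.≤ b → ι a ℚ.≤ ι b
ι-mono-≤ {a} {b} a≤b rewrite ι≡mkℚ a | ι≡mkℚ b = ℚ.*≤* (subst₂ ℤ._≤_ (sym (ℤP.*-identityʳ a)) (sym (ℤP.*-identityʳ b)) a≤b)

p≤∣↥p∣ : ∀ p → p ℚ.≤ ι (+ ℤ.∣ ℚ.↥ p ∣)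
p≤∣↥p∣ (mkℚ (+ a) D-1 _) rewrite ι≡mkℚ (+ a) =
  ℚ.*≤* (subst₂ ℤ._≤_ (ℤP.pos-* a 1) (ℤP.pos-* a (suc D-1)) (ℤ.+≤+ (ℕP.*-monoʳ-≤ a (ℕ.s≤s ℕ.z≤n))))
p≤∣↥p∣ (mkℚ -[1+ a ] D-1 _) rewrite ι≡mkℚ (+ suc a) = ℚ.*≤* ℤ.-≤+

-- Parities and sums of squares modulo 4

OfParity : ℕ → ℕ → Set
OfParity σ a = Σ ℕ λ j → a ≡ σ ℕ.+ 2 ℕ.* j

even-or-odd : ∀ a → Σ ℕ λ σ → σ ≤ 1 × OfParity σ a
even-or-odd a = a % 2 , ℕP.<⇒≤pred (m%n<n a 2) , a ℕ./ 2 ,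
  trans (m≡m%n+[m/n]*n a 2) (cong (a % 2 ℕ.+_) (ℕP.*-comm (a ℕ./ 2) 2))

residues-mod-4 : ∀ {σ τ} r → σ ≤ 1 → τ ≤ 1 → r ≢ 0 → r < 4 →
  (σ ℕ.* σ ℕ.+ r ℕ.* (τ ℕ.* τ)) % 4 ≡ 0 → σ ≡ τ × (σ ≡ 1 → r ≡ 3)
residues-mod-4 0 _ _ r≢0 _ _ = ⊥-elim (r≢0 refl)
residues-mod-4 (suc (suc (suc (suc _)))) _ _ _ (s≤s (s≤s (s≤s (s≤s ())))) _
residues-mod-4 _ z≤n z≤n _ _ _ = refl , λ ()
residues-mod-4 3 (s≤s z≤n) (s≤s z≤n) _ _ _ = refl , λ _ → refl
residues-mod-4 1 z≤n (s≤s z≤n) _ _ ()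
residues-mod-4 2 z≤n (s≤s z≤n) _ _ ()
residues-mod-4 3 z≤n (s≤s z≤n) _ _ ()
residues-mod-4 1 (s≤s z≤n) z≤n _ _ ()
residues-mod-4 2 (s≤s z≤n) z≤n _ _ ()
residues-mod-4 3 (s≤s z≤n) z≤n _ _ ()
residues-mod-4 1 (s≤s z≤n) (s≤s z≤n) _ _ ()
residues-mod-4 2 (s≤s z≤n) (s≤s z≤n) _ _ ()

reduce-mod-4 : ∀ d σ a′ τ b′ k →
  (σ ℕ.+ 2 ℕ.* a′) ℕ.* (σ ℕ.+ 2 ℕ.* a′) ℕ.+ d ℕ.* ((τ ℕ.+ 2 ℕ.* b′) ℕ.* (τ ℕ.+ 2 ℕ.* b′)) ≡ 4 ℕ.* k →
  (σ ℕ.* σ ℕ.+ d % 4 ℕ.* (τ ℕ.* τ)) % 4 ≡ 0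
reduce-mod-4 d σ a′ τ b′ k eq = begin
  (σ ℕ.* σ ℕ.+ r ℕ.* (τ ℕ.* τ)) % 4              ≡⟨ [m+kn]%n≡m%n (σ ℕ.* σ ℕ.+ r ℕ.* (τ ℕ.* τ)) X 4 ⟨
  (σ ℕ.* σ ℕ.+ r ℕ.* (τ ℕ.* τ) ℕ.+ X ℕ.* 4) % 4  ≡⟨ cong (_% 4) (expand σ a′ τ b′ r q) ⟨
  (A ℕ.* A ℕ.+ (r ℕ.+ q ℕ.* 4) ℕ.* (B ℕ.* B)) % 4 ≡⟨ cong (λ d′ → (A ℕ.* A ℕ.+ d′ ℕ.* (B ℕ.* B)) % 4) (m≡m%n+[m/n]*n d 4) ⟨
  (A ℕ.* A ℕ.+ d ℕ.* (B ℕ.* B)) % 4              ≡⟨ cong (_% 4) (trans eq (ℕP.*-comm 4 k)) ⟩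
  (k ℕ.* 4) % 4                                  ≡⟨ m*n%n≡0 k 4 ⟩
  0                                              ∎
  where
  open ≡-Reasoning
  r = d % 4
  q = d ℕ./ 4
  A = σ ℕ.+ 2 ℕ.* a′
  B = τ ℕ.+ 2 ℕ.* b′
  X = σ ℕ.* a′ ℕ.+ a′ ℕ.* a′ ℕ.+ r ℕ.* (τ ℕ.* b′ ℕ.+ b′ ℕ.* b′) ℕ.+ q ℕ.* (B ℕ.* B)
  expand : ∀ σ a′ τ b′ r q →
    (σ ℕ.+ 2 ℕ.* a′) ℕ.* (σ ℕ.+ 2 ℕ.* a′) ℕ.+ (r ℕ.+ q ℕ.* 4) ℕ.* ((τ ℕ.+ 2 ℕ.* b′) ℕ.* (τ ℕ.+ 2 ℕ.* b′))
    ≡ σ ℕ.* σ ℕ.+ r ℕ.* (τ ℕ.* τ)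
      ℕ.+ (σ ℕ.* a′ ℕ.+ a′ ℕ.* a′ ℕ.+ r ℕ.* (τ ℕ.* b′ ℕ.+ b′ ℕ.* b′) ℕ.+ q ℕ.* ((τ ℕ.+ 2 ℕ.* b′) ℕ.* (τ ℕ.+ 2 ℕ.* b′))) ℕ.* 4
  expand = ℕ-Solver.solve-∀

module _ {d : ℕ} (sf : SquareFree d) where

  squarefree-%4≢0 : d % 4 ≢ 0
  squarefree-%4≢0 eq with sf 2 (m%n≡0⇒n∣m d 4 eq)
  ... | ()

  squarefree-denominator : ∀ r D .{{_ : NonZero D}} → Coprime r D → D ℕ.* D ∣ r ℕ.* r ℕ.* d → D ≡ 1
  squarefree-denominator r D r⊥D D²∣r²d = sf D (divides f (trans (trans d≡eD (cong (ℕ._* D) e≡fD)) (ℕP.*-assoc f D D)))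
    where
    D⊥r : Coprime D r
    D⊥r = Coprime.sym r⊥D
    cancel-r² : ∀ {m} → D ∣ r ℕ.* r ℕ.* m → D ∣ m
    cancel-r² {m} h = coprime-divisor D⊥r (coprime-divisor D⊥r (subst (D ∣_) (ℕP.*-assoc r r m) h))
    D∣d : D ∣ d
    D∣d = cancel-r² (∣-trans (m∣m*n D) D²∣r²d)
    e = _∣_.quotient D∣d
    d≡eD : d ≡ e ℕ.* D
    d≡eD = _∣_.equality D∣d
    D∣e : D ∣ e
    D∣e = cancel-r² (*-cancelʳ-∣ D (subst (D ℕ.* D ∣_) (trans (cong (r ℕ.* r ℕ.*_) d≡eD) (sym (ℕP.*-assoc (r ℕ.* r) e D))) D²∣r²d))
    f = _∣_.quotient D∣e
    e≡fD : e ≡ f ℕ.* D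
    e≡fD = _∣_.equality D∣e


  squarefree-parities : ∀ a b k → a ℕ.* a ℕ.+ d ℕ.* (b ℕ.* b) ≡ 4 ℕ.* k →
    Σ ℕ λ σ → σ ≤ 1 × OfParity σ a × OfParity σ b × (σ ≡ 1 → d % 4 ≡ 3)
  squarefree-parities a b k eq with even-or-odd a | even-or-odd b
  ... | σ , σ≤1 , a′ , refl | τ , τ≤1 , b′ , refl =
    same-parity (residues-mod-4 (d % 4) σ≤1 τ≤1 squarefree-%4≢0 (m%n<n d 4) (reduce-mod-4 d σ a′ τ b′ k eq))
    where
    same-parity : σ ≡ τ × (σ ≡ 1 → d % 4 ≡ 3) →
      Σ ℕ λ σ′ → σ′ ≤ 1 × OfParity σ′ (σ ℕ.+ 2 ℕ.* a′) × OfParity σ′ (τ ℕ.+ 2 ℕ.* b′) × (σ′ ≡ 1 → d % 4 ≡ 3)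
    same-parity (refl , σ≡1⇒d≡3) = σ , σ≤1 , (a′ , refl) , (b′ , refl) , σ≡1⇒d≡3

pos-σ+2j : ∀ σ j → + (σ ℕ.+ 2 ℕ.* j) ≡ + σ ℤ.+ + 2 ℤ.* + j
pos-σ+2j σ j = trans (ℤP.pos-+ σ (2 ℕ.* j)) (cong (ℤ._+_ (+ σ)) (ℤP.pos-* 2 j))

OfParity-∣∣⁺ : ∀ {σ} → σ ≤ 1 → ∀ a → OfParity σ ℤ.∣ + σ ℤ.+ + 2 ℤ.* a ∣
OfParity-∣∣⁺ z≤n a = ℤ.∣ a ∣ , trans (cong ℤ.∣_∣ (ℤP.+-identityˡ (+ 2 ℤ.* a))) (ℤP.abs-* (+ 2) a)
OfParity-∣∣⁺ (s≤s z≤n) (+ k)    = k , cong ℤ.∣_∣ (sym (pos-σ+2j 1 k))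
OfParity-∣∣⁺ (s≤s z≤n) -[1+ k ] = k , (begin
  ℤ.∣ + 1 ℤ.+ + 2 ℤ.* ℤ.- (+ 1 ℤ.+ + k) ∣  ≡⟨ cong ℤ.∣_∣ (reflect (+ k)) ⟩
  ℤ.∣ ℤ.- (+ 1 ℤ.+ + 2 ℤ.* + k) ∣          ≡⟨ ℤP.∣-i∣≡∣i∣ (+ 1 ℤ.+ + 2 ℤ.* + k) ⟩
  ℤ.∣ + 1 ℤ.+ + 2 ℤ.* + k ∣                ≡⟨ cong ℤ.∣_∣ (pos-σ+2j 1 k) ⟨
  1 ℕ.+ 2 ℕ.* k                             ∎)
  where
  open ≡-Reasoning
  reflect : ∀ K → + 1 ℤ.+ + 2 ℤ.* ℤ.- (+ 1 ℤ.+ K) ≡ ℤ.- (+ 1 ℤ.+ + 2 ℤ.* K)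
  reflect = ℤ-Solver.solve-∀

OfParity-∣∣⁻ : ∀ {σ} → σ ≤ 1 → ∀ z → OfParity σ ℤ.∣ z ∣ → Σ ℤ λ a → z ≡ + σ ℤ.+ + 2 ℤ.* a
OfParity-∣∣⁻ {σ} _ (+ n) (j , refl) = + j , pos-σ+2j σ j
OfParity-∣∣⁻ z≤n -[1+ n ] (j , eq) = ℤ.- + j , (begin
  ℤ.- (+ suc n)          ≡⟨ cong (λ m → ℤ.- (+ m)) eq ⟩
  ℤ.- (+ (2 ℕ.* j))      ≡⟨ cong ℤ.-_ (ℤP.pos-* 2 j) ⟩
  ℤ.- (+ 2 ℤ.* + j)      ≡⟨ reflect (+ j) ⟩
  + 0 ℤ.+ + 2 ℤ.* ℤ.- + j ∎)
  where
  open ≡-Reasoning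
  reflect : ∀ J → ℤ.- (+ 2 ℤ.* J) ≡ + 0 ℤ.+ + 2 ℤ.* ℤ.- J
  reflect = ℤ-Solver.solve-∀
OfParity-∣∣⁻ (s≤s z≤n) -[1+ n ] (j , eq) = ℤ.- (+ 1 ℤ.+ + j) , (begin
  ℤ.- (+ suc n)                 ≡⟨ cong (λ m → ℤ.- (+ m)) eq ⟩
  ℤ.- (+ (1 ℕ.+ 2 ℕ.* j))       ≡⟨ cong ℤ.-_ (pos-σ+2j 1 j) ⟩
  ℤ.- (+ 1 ℤ.+ + 2 ℤ.* + j)     ≡⟨ reflect (+ j) ⟩
  + 1 ℤ.+ + 2 ℤ.* ℤ.- (+ 1 ℤ.+ + j) ∎)
  where
  open ≡-Reasoning
  reflect : ∀ J → ℤ.- (+ 1 ℤ.+ + 2 ℤ.* J) ≡ + 1 ℤ.+ + 2 ℤ.* ℤ.- (+ 1 ℤ.+ J)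
  reflect = ℤ-Solver.solve-∀

square≡∣∣² : ∀ i → i ℤ.* i ≡ + (ℤ.∣ i ∣ ℕ.* ℤ.∣ i ∣)
square≡∣∣² (+ n)    = sym (ℤP.pos-* n n)
square≡∣∣² -[1+ n ] = refl

sum-of-squares-∣∣ : ∀ d s n k → s ℤ.* s ℤ.+ + d ℤ.* (n ℤ.* n) ≡ + 4 ℤ.* k →
  ℤ.∣ s ∣ ℕ.* ℤ.∣ s ∣ ℕ.+ d ℕ.* (ℤ.∣ n ∣ ℕ.* ℤ.∣ n ∣) ≡ 4 ℕ.* ℤ.∣ k ∣
sum-of-squares-∣∣ d s n k eq = begin
  S ℕ.+ d ℕ.* N                            ≡⟨ cong ℤ.∣_∣ (trans (ℤP.pos-+ S (d ℕ.* N)) (cong (ℤ._+_ (+ S)) (ℤP.pos-* d N))) ⟩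
  ℤ.∣ + S ℤ.+ + d ℤ.* + N ∣                ≡⟨ cong ℤ.∣_∣ (cong₂ (λ a b → a ℤ.+ + d ℤ.* b) (square≡∣∣² s) (square≡∣∣² n)) ⟨
  ℤ.∣ s ℤ.* s ℤ.+ + d ℤ.* (n ℤ.* n) ∣      ≡⟨ cong ℤ.∣_∣ eq ⟩
  ℤ.∣ + 4 ℤ.* k ∣                          ≡⟨ ℤP.abs-* (+ 4) k ⟩
  4 ℕ.* ℤ.∣ k ∣                            ∎
  where
  open ≡-Reasoning
  S = ℤ.∣ s ∣ ℕ.* ℤ.∣ s ∣
  N = ℤ.∣ n ∣ ℕ.* ℤ.∣ n ∣

-- Integers listed by absolute value

withAbs : ℕ → List ℤ
withAbs zero    = + 0 ∷ []
withAbs (suc k) = + suc k ∷ -[1+ k ] ∷ []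

∈-withAbs⁺ : ∀ m → m ∈ withAbs ℤ.∣ m ∣
∈-withAbs⁺ (+ zero) = here refl
∈-withAbs⁺ +[1+ k ] = here refl
∈-withAbs⁺ -[1+ k ] = there (here refl)

∈-withAbs⁻ : ∀ k {m} → m ∈ withAbs k → ℤ.∣ m ∣ ≡ k
∈-withAbs⁻ zero    (here refl)         = refl
∈-withAbs⁻ (suc k) (here refl)         = refl
∈-withAbs⁻ (suc k) (there (here refl)) = refl

withAbs-unique : ∀ k → Unique (withAbs k)
withAbs-unique zero    = All.[] AllPairs.∷ AllPairs.[]
withAbs-unique (suc k) = ((λ ()) All.∷ All.[]) AllPairs.∷ All.[] AllPairs.∷ AllPairs.[]

length-withAbs : ∀ {k} → 0 < k → length (withAbs k) ≡ 2
length-withAbs {suc k} _ = refl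

parityInterval : ℕ → ℕ → List ℤ
parityInterval e zero    = withAbs e
parityInterval e (suc b) = withAbs (e ℕ.+ 2 ℕ.* suc b) ++ parityInterval e b

∈-parityInterval⁺ : ∀ {e b i} m → i ≤ b → ℤ.∣ m ∣ ≡ e ℕ.+ 2 ℕ.* i → m ∈ parityInterval e b
∈-parityInterval⁺ {e} {zero} m z≤n ∣m∣≡ = subst (λ k → m ∈ withAbs k) (trans ∣m∣≡ (ℕP.+-identityʳ e)) (∈-withAbs⁺ m)
∈-parityInterval⁺ {e} {suc b} {i} m i≤1+b ∣m∣≡ with ℕP.m≤n⇒m<n∨m≡n i≤1+b
... | inj₁ (s≤s i≤b) = ∈-++⁺ʳ (withAbs (e ℕ.+ 2 ℕ.* suc b)) (∈-parityInterval⁺ m i≤b ∣m∣≡)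
... | inj₂ refl      = ∈-++⁺ˡ (subst (λ k → m ∈ withAbs k) ∣m∣≡ (∈-withAbs⁺ m))

∈-parityInterval⁻ : ∀ e b {m} → m ∈ parityInterval e b → Σ ℕ λ i → i ≤ b × ℤ.∣ m ∣ ≡ e ℕ.+ 2 ℕ.* i
∈-parityInterval⁻ e zero m∈ = 0 , z≤n , trans (∈-withAbs⁻ e m∈) (sym (ℕP.+-identityʳ e))
∈-parityInterval⁻ e (suc b) m∈ with ∈-++⁻ (withAbs (e ℕ.+ 2 ℕ.* suc b)) m∈
... | inj₁ m∈withAbs = suc b , ℕP.≤-refl , ∈-withAbs⁻ _ m∈withAbs
... | inj₂ m∈rest with ∈-parityInterval⁻ e b m∈rest
...   | i , i≤b , ∣m∣≡ = i , ℕP.m≤n⇒m≤1+n i≤b , ∣m∣≡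

parityInterval-unique : ∀ e b → Unique (parityInterval e b)
parityInterval-unique e zero    = withAbs-unique e
parityInterval-unique e (suc b) = Unique.++⁺ (withAbs-unique _) (parityInterval-unique e b) disjoint
  where
  disjoint : ∀ {m} → ¬ (m ∈ withAbs (e ℕ.+ 2 ℕ.* suc b) × m ∈ parityInterval e b)
  disjoint (m∈withAbs , m∈rest) with ∈-parityInterval⁻ e b m∈rest
  ... | i , i≤b , ∣m∣≡ = ℕP.<⇒≢ (s≤s i≤b)
    (ℕP.*-cancelˡ-≡ i (suc b) 2 (ℕP.+-cancelˡ-≡ e _ _ (trans (sym ∣m∣≡) (∈-withAbs⁻ _ m∈withAbs))))

length-parityInterval : ∀ {e} → e ≤ 1 → ∀ b → length (parityInterval e b) ≡ suc (e ℕ.+ 2 ℕ.* b)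
length-parityInterval z≤n       zero = refl
length-parityInterval (s≤s z≤n) zero = refl
length-parityInterval {e} e≤1 (suc b) = begin
  length (withAbs (e ℕ.+ 2 ℕ.* suc b) ++ parityInterval e b)  ≡⟨ List.length-++ (withAbs (e ℕ.+ 2 ℕ.* suc b)) ⟩
  length (withAbs (e ℕ.+ 2 ℕ.* suc b)) ℕ.+ length (parityInterval e b)
    ≡⟨ cong₂ ℕ._+_ (length-withAbs (ℕP.<-≤-trans (s≤s z≤n) (ℕP.m≤n+m (2 ℕ.* suc b) e))) (length-parityInterval e≤1 b) ⟩
  2 ℕ.+ suc (e ℕ.+ 2 ℕ.* b)                                     ≡⟨ shift e b ⟩
  suc (e ℕ.+ 2 ℕ.* suc b)                                       ∎
  where
  open ≡-Reasoning
  shift : ∀ e b → 2 ℕ.+ suc (e ℕ.+ 2 ℕ.* b) ≡ suc (e ℕ.+ 2 ℕ.* suc b)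
  shift = ℕ-Solver.solve-∀

boundary : ∀ {P : ℕ → Set} → Decidable P → P 0 → ∀ M → ¬ P M → Σ ℕ λ b → P b × ¬ P (suc b)
boundary P? P0 zero    ¬P0 = ⊥-elim (¬P0 P0)
boundary P? P0 (suc M) ¬PM+1 with P? M
... | yes PM = M , PM , ¬PM+1
... | no ¬PM = boundary P? P0 M ¬PM

-- The lattices ℤ + ℤγ and Weil generators

module _ (d : ℕ) where
  open QuadField d

  isInteger-ι : ∀ z → IsInteger (ι z)
  isInteger-ι z = z , refl

  isInteger-+ : ∀ {p q} → IsInteger p → IsInteger q → IsInteger (p ℚ.+ q)
  isInteger-+ (a , refl) (b , refl) = a ℤ.+ b , sym (ι-homo-+ a b)

  isInteger-* : ∀ {p q} → IsInteger p → IsInteger q → IsInteger (p ℚ.* q)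
  isInteger-* (a , refl) (b , refl) = a ℤ.* b , sym (ι-homo-* a b)

  isInteger-neg : ∀ {p} → IsInteger p → IsInteger (ℚ.- p)
  isInteger-neg (a , refl) = ℤ.- a , sym (ι-homo-neg a)

  isInteger-unit : ∀ {w v} → IsInteger w → IsInteger v → w ℚ.* v ≡ 1ℚ → v ≡ 1ℚ ⊎ v ≡ ℚ.- 1ℚ
  isInteger-unit (w , refl) (v , refl) wv≡1 = Sum.map (cong ι) (cong ι) (i*j≡1⇒j≡±1 {w} (ι-injective {w ℤ.* v} {+ 1} (trans (ι-homo-* w v) wv≡1)))

  _∈ℤ+ℤ_ : K → K → Set
  β ∈ℤ+ℤ (x , y) = Σ ℚ λ u → Σ ℚ λ v → IsInteger u × IsInteger v × β ≡ (u ℚ.+ v ℚ.* x , v ℚ.* y)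

  ∈ℤ+ℤ-refl : ∀ γ → γ ∈ℤ+ℤ γ
  ∈ℤ+ℤ-refl (x , y) = 0ℚ , 1ℚ , isInteger-ι (+ 0) , isInteger-ι (+ 1) ,
    cong₂ _,_ (solve (x ∷ []) ℚ-ring) (solve (y ∷ []) ℚ-ring)

  ∈ℤ+ℤ-trans : ∀ {β ω α} → β ∈ℤ+ℤ ω → ω ∈ℤ+ℤ α → β ∈ℤ+ℤ α
  ∈ℤ+ℤ-trans {α = x , y} (u , v , iu , iv , refl) (u′ , v′ , iu′ , iv′ , refl) =
    u ℚ.+ v ℚ.* u′ , v ℚ.* v′ , isInteger-+ iu (isInteger-* iv iu′) , isInteger-* iv iv′ ,
    cong₂ _,_ (solve (u ∷ v ∷ u′ ∷ v′ ∷ x ∷ []) ℚ-ring) (solve (v ∷ v′ ∷ y ∷ []) ℚ-ring)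

  fromℤK-∈ℤ+ℤ : ∀ c γ → fromℤK c ∈ℤ+ℤ γ
  fromℤK-∈ℤ+ℤ c (x , y) = ι c , 0ℚ , isInteger-ι c , isInteger-ι (+ 0) ,
    cong₂ _,_ (constant-as-linear (ι c) x) (solve (y ∷ []) ℚ-ring)
    where
    constant-as-linear : ∀ c x → c ≡ c ℚ.+ 0ℚ ℚ.* x
    constant-as-linear = solve-∀ ℚ-ring

  module _ {x y : ℚ} (γ-integral : InO (x , y)) where
    private
      t-integral = proj₁ γ-integral
      n-integral = proj₂ γ-integral

    conj-∈ℤ+ℤ : conj (x , y) ∈ℤ+ℤ (x , y)
    conj-∈ℤ+ℤ = x ℚ.+ x , ℚ.- 1ℚ , t-integral , isInteger-neg (isInteger-ι (+ 1)) ,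
      cong₂ _,_ (solve (x ∷ []) ℚ-ring) (solve (y ∷ []) ℚ-ring)

    ∈ℤ+ℤ-+K : ∀ {β δ} → β ∈ℤ+ℤ (x , y) → δ ∈ℤ+ℤ (x , y) → (β +K δ) ∈ℤ+ℤ (x , y)
    ∈ℤ+ℤ-+K (u , v , iu , iv , refl) (u′ , v′ , iu′ , iv′ , refl) =
      u ℚ.+ u′ , v ℚ.+ v′ , isInteger-+ iu iu′ , isInteger-+ iv iv′ ,
      cong₂ _,_ (solve (u ∷ v ∷ u′ ∷ v′ ∷ x ∷ []) ℚ-ring) (solve (v ∷ v′ ∷ y ∷ []) ℚ-ring)

    ∈ℤ+ℤ-*K : ∀ {β δ} → β ∈ℤ+ℤ (x , y) → δ ∈ℤ+ℤ (x , y) → (β *K δ) ∈ℤ+ℤ (x , y)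
    ∈ℤ+ℤ-*K (u , v , iu , iv , refl) (u′ , v′ , iu′ , iv′ , refl) =
      u ℚ.* u′ ℚ.- v ℚ.* v′ ℚ.* (x ℚ.* x ℚ.+ dℚ ℚ.* (y ℚ.* y)) , u ℚ.* v′ ℚ.+ u′ ℚ.* v ℚ.+ v ℚ.* v′ ℚ.* (x ℚ.+ x) ,
      isInteger-+ (isInteger-* iu iu′) (isInteger-neg (isInteger-* (isInteger-* iv iv′) n-integral)) ,
      isInteger-+ (isInteger-+ (isInteger-* iu iv′) (isInteger-* iu′ iv)) (isInteger-* (isInteger-* iv iv′) t-integral) ,
      cong₂ _,_ (first-coordinate u v u′ v′ x y dℚ) (solve (u ∷ v ∷ u′ ∷ v′ ∷ x ∷ y ∷ []) ℚ-ring)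
      where
      first-coordinate : ∀ u v u′ v′ x y D →
        (u ℚ.+ v ℚ.* x) ℚ.* (u′ ℚ.+ v′ ℚ.* x) ℚ.- D ℚ.* ((v ℚ.* y) ℚ.* (v′ ℚ.* y))
        ≡ (u ℚ.* u′ ℚ.- v ℚ.* v′ ℚ.* (x ℚ.* x ℚ.+ D ℚ.* (y ℚ.* y)))
          ℚ.+ (u ℚ.* v′ ℚ.+ u′ ℚ.* v ℚ.+ v ℚ.* v′ ℚ.* (x ℚ.+ x)) ℚ.* x
      first-coordinate = solve-∀ ℚ-ring

    ∈ℤ+ℤ-^K : ∀ {β} → β ∈ℤ+ℤ (x , y) → ∀ k → (β ^K k) ∈ℤ+ℤ (x , y)
    ∈ℤ+ℤ-^K β∈ zero    = fromℤK-∈ℤ+ℤ (+ 1) (x , y)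
    ∈ℤ+ℤ-^K β∈ (suc k) = ∈ℤ+ℤ-*K β∈ (∈ℤ+ℤ-^K β∈ k)

    eval2-∈ℤ+ℤ : ∀ P → eval2 P (x , y) (conj (x , y)) ∈ℤ+ℤ (x , y)
    eval2-∈ℤ+ℤ []                  = fromℤK-∈ℤ+ℤ (+ 0) (x , y)
    eval2-∈ℤ+ℤ ((c , i , j) ∷ P) =
      ∈ℤ+ℤ-+K (∈ℤ+ℤ-*K (∈ℤ+ℤ-*K (fromℤK-∈ℤ+ℤ c (x , y)) (∈ℤ+ℤ-^K (∈ℤ+ℤ-refl (x , y)) i))
                        (∈ℤ+ℤ-^K conj-∈ℤ+ℤ j))
              (eval2-∈ℤ+ℤ P)

    ∈ℤ+ℤ⇒InO : ∀ {β} → β ∈ℤ+ℤ (x , y) → InO β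
    ∈ℤ+ℤ⇒InO (u , v , iu , iv , refl) =
      subst IsInteger (sym (trace-expansion u v x))
        (isInteger-+ (isInteger-+ iu iu) (isInteger-* iv t-integral)) ,
      subst IsInteger (sym (norm-expansion u v x y dℚ))
        (isInteger-+ (isInteger-+ (isInteger-* iu iu) (isInteger-* (isInteger-* iu iv) t-integral))
                     (isInteger-* (isInteger-* iv iv) n-integral))
      where
      trace-expansion : ∀ u v x → (u ℚ.+ v ℚ.* x) ℚ.+ (u ℚ.+ v ℚ.* x) ≡ (u ℚ.+ u) ℚ.+ v ℚ.* (x ℚ.+ x)
      trace-expansion = solve-∀ ℚ-ring
      norm-expansion : ∀ u v x y D →
        (u ℚ.+ v ℚ.* x) ℚ.* (u ℚ.+ v ℚ.* x) ℚ.+ D ℚ.* ((v ℚ.* y) ℚ.* (v ℚ.* y))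
        ≡ u ℚ.* u ℚ.+ u ℚ.* v ℚ.* (x ℚ.+ x) ℚ.+ v ℚ.* v ℚ.* (x ℚ.* x ℚ.+ D ℚ.* (y ℚ.* y))
      norm-expansion = solve-∀ ℚ-ring

  *K-identityʳ : ∀ α → α *K fromℤK (+ 1) ≡ α
  *K-identityʳ (a , b) = cong₂ _,_ (first-coordinate a b dℚ) (solve (a ∷ b ∷ []) ℚ-ring)
    where
    first-coordinate : ∀ a b D → a ℚ.* 1ℚ ℚ.- D ℚ.* (b ℚ.* 0ℚ) ≡ a
    first-coordinate = solve-∀ ℚ-ring

  +K-identityʳ : ∀ α → α +K fromℤK (+ 0) ≡ α
  +K-identityʳ (a , b) = cong₂ _,_ (ℚP.+-identityʳ a) (ℚP.+-identityʳ b)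

  fromℤK-*K : ∀ c a b → fromℤK c *K (a , b) ≡ (ι c ℚ.* a , ι c ℚ.* b)
  fromℤK-*K c a b = cong₂ _,_ (first-coordinate (ι c) a b dℚ) (second-coordinate (ι c) a b)
    where
    first-coordinate : ∀ c a b D → c ℚ.* a ℚ.- D ℚ.* (0ℚ ℚ.* b) ≡ c ℚ.* a
    first-coordinate = solve-∀ ℚ-ring
    second-coordinate : ∀ c a b → c ℚ.* b ℚ.+ 0ℚ ℚ.* a ≡ c ℚ.* b
    second-coordinate = solve-∀ ℚ-ring

  *K-conj : ∀ α → α *K conj α ≡ (norm α , 0ℚ)
  *K-conj (x , y) = cong₂ _,_ (first-coordinate x y dℚ) (second-coordinate x y)
    where
    second-coordinate : ∀ x y → x ℚ.* ℚ.- y ℚ.+ y ℚ.* x ≡ 0ℚ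
    second-coordinate = solve-∀ ℚ-ring
    first-coordinate : ∀ x y D → x ℚ.* x ℚ.- D ℚ.* (y ℚ.* ℚ.- y) ≡ x ℚ.* x ℚ.+ D ℚ.* (y ℚ.* y)
    first-coordinate = solve-∀ ℚ-ring

  linear : ℤ → ℤ → Poly2
  linear u v = (u , 0 , 0) ∷ (v , 1 , 0) ∷ []

  eval2-linear : ∀ u v x y → eval2 (linear u v) (x , y) (conj (x , y)) ≡ (ι u ℚ.+ ι v ℚ.* x , ι v ℚ.* y)
  eval2-linear u v x y = begin
    ((fromℤK u *K one) *K one) +K (((fromℤK v *K ((x , y) *K one)) *K one) +K fromℤK (+ 0))
      ≡⟨ cong₂ _+K_ (trans (*K-identityʳ (fromℤK u *K one)) (*K-identityʳ (fromℤK u)))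
                    (trans (+K-identityʳ ((fromℤK v *K ((x , y) *K one)) *K one))
                           (*K-identityʳ (fromℤK v *K ((x , y) *K one)))) ⟩
    fromℤK u +K (fromℤK v *K ((x , y) *K one))
      ≡⟨ cong (λ α → fromℤK u +K (fromℤK v *K α)) (*K-identityʳ (x , y)) ⟩
    fromℤK u +K (fromℤK v *K (x , y))
      ≡⟨ cong (fromℤK u +K_) (fromℤK-*K v x y) ⟩
    (ι u ℚ.+ ι v ℚ.* x , 0ℚ ℚ.+ ι v ℚ.* y)
      ≡⟨ cong (ι u ℚ.+ ι v ℚ.* x ,_) (ℚP.+-identityˡ _) ⟩
    (ι u ℚ.+ ι v ℚ.* x , ι v ℚ.* y) ∎
    where
    open ≡-Reasoning
    one = fromℤK (+ 1)

  ∈ℤ+ℤ⇒InZAlphaAlphaBar : ∀ {α β} → β ∈ℤ+ℤ α → InZAlphaAlphaBar α β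
  ∈ℤ+ℤ⇒InZAlphaAlphaBar {x , y} (_ , _ , (u , refl) , (v , refl) , refl) = linear u v , eval2-linear u v x y

  InZAlphaAlphaBar⇒∈ℤ+ℤ : ∀ {α β} → InO α → InZAlphaAlphaBar α β → β ∈ℤ+ℤ α
  InZAlphaAlphaBar⇒∈ℤ+ℤ {x , y} α-integral (P , refl) = eval2-∈ℤ+ℤ α-integral P

  _∈ℤ±_ : K → K → Set
  α ∈ℤ± (a , b) = Σ ℚ λ c → IsInteger c × (α ≡ (c ℚ.+ a , b) ⊎ α ≡ (c ℚ.- a , ℚ.- b))

  record IsIntegralBasis (ω : K) : Set where
    field
      integral   : InO ω
      spans      : ∀ {β} → InO β → β ∈ℤ+ℤ ω
      irrational : proj₂ ω ≢ 0ℚ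

  module _ {a b : ℚ} (basis : IsIntegralBasis (a , b)) where
    open IsIntegralBasis basis

    ∈ℤ±⇒∈ℤ+ℤ : ∀ {α} → α ∈ℤ± (a , b) → α ∈ℤ+ℤ (a , b)
    ∈ℤ±⇒∈ℤ+ℤ (c , ic , inj₁ refl) = c , 1ℚ , ic , isInteger-ι (+ 1) ,
      cong₂ _,_ (solve (c ∷ a ∷ []) ℚ-ring) (solve (b ∷ []) ℚ-ring)
    ∈ℤ±⇒∈ℤ+ℤ (c , ic , inj₂ refl) = c , ℚ.- 1ℚ , ic , isInteger-neg (isInteger-ι (+ 1)) ,
      cong₂ _,_ (solve (c ∷ a ∷ []) ℚ-ring) (solve (b ∷ []) ℚ-ring)

    ∈ℤ±⇒generator∈ℤ+ℤ : ∀ {α} → α ∈ℤ± (a , b) → (a , b) ∈ℤ+ℤ α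
    ∈ℤ±⇒generator∈ℤ+ℤ (c , ic , inj₁ refl) = ℚ.- c , 1ℚ , isInteger-neg ic , isInteger-ι (+ 1) ,
      cong₂ _,_ (solve (c ∷ a ∷ []) ℚ-ring) (solve (b ∷ []) ℚ-ring)
    ∈ℤ±⇒generator∈ℤ+ℤ (c , ic , inj₂ refl) = c , ℚ.- 1ℚ , ic , isInteger-neg (isInteger-ι (+ 1)) ,
      cong₂ _,_ (solve (c ∷ a ∷ []) ℚ-ring) (solve (b ∷ []) ℚ-ring)

    ∈ℤ±⇒IsWeilGenerator : ∀ {α} → α ∈ℤ± (a , b) → IsWeilGenerator α
    ∈ℤ±⇒IsWeilGenerator {α} α∈ =
      α-integral ,
      subst IsInteger (sym (cong proj₁ (*K-conj α))) (proj₂ α-integral) ,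
      cong proj₂ (*K-conj α) ,
      (λ β β-integral → ∈ℤ+ℤ⇒InZAlphaAlphaBar (∈ℤ+ℤ-trans (spans β-integral) (∈ℤ±⇒generator∈ℤ+ℤ α∈))) ,
      (λ β β∈ → ∈ℤ+ℤ⇒InO α-integral (InZAlphaAlphaBar⇒∈ℤ+ℤ α-integral β∈))
      where
      α-integral : InO α
      α-integral = ∈ℤ+ℤ⇒InO integral (∈ℤ±⇒∈ℤ+ℤ α∈)

    -- α = u + vω, and ω ∈ ℤ[α, ᾱ] = ℤ + ℤα gives ω = u′ + wα; comparing √-d-coordinates, wv = 1.
    IsWeilGenerator⇒∈ℤ± : ∀ {α} → IsWeilGenerator α → α ∈ℤ± (a , b)
    IsWeilGenerator⇒∈ℤ± {α} (α-integral , _ , _ , O⊆ℤ[α,ᾱ] , _)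
      with spans {α} α-integral | InZAlphaAlphaBar⇒∈ℤ+ℤ α-integral (O⊆ℤ[α,ᾱ] (a , b) integral)
    ... | u , v , iu , iv , refl | _ , w , _ , iw , ω≡ with isInteger-unit iw iv wv≡1
      where
      wv≡1 : w ℚ.* v ≡ 1ℚ
      wv≡1 = p*q≡q⇒p≡1 irrational (trans (ℚP.*-assoc w v b) (sym (cong proj₂ ω≡)))
    ... | inj₁ refl = u , iu , inj₁ (cong₂ _,_ (cong (u ℚ.+_) (ℚP.*-identityˡ a)) (ℚP.*-identityˡ b))
    ... | inj₂ refl = u , iu , inj₂ (cong₂ _,_ (solve (u ∷ a ∷ []) ℚ-ring) (solve (b ∷ []) ℚ-ring))

    IsWeilGenerator⇔∈ℤ± : ∀ α → IsWeilGenerator α ⇔ α ∈ℤ± (a , b)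
    IsWeilGenerator⇔∈ℤ± α = mk⇔ IsWeilGenerator⇒∈ℤ± ∈ℤ±⇒IsWeilGenerator

-- Integral bases of 𝒪_K

module _ {d : ℕ} (sf : SquareFree d) where
  open QuadField d

  q²d-integral⇒q-integral : ∀ q → IsInteger (q ℚ.* q ℚ.* dℚ) → IsInteger q
  q²d-integral⇒q-integral q@(mkℚ r D-1 r⊥D) (w , q²d≡w) =
    r , trans (ℚP.mkℚ-cong refl (ℕP.suc-injective D≡1)) (sym (ι≡mkℚ r))
    where
    D = suc D-1
    cross-multiplied : r ℤ.* r ℤ.* + d ℤ.* + 1 ≡ w ℤ.* + (D ℕ.* D ℕ.* 1)
    cross-multiplied
      with ℚᵘP.≃-trans (ℚᵘP.≃-sym (ℚᵘP.≃-trans (ℚP.toℚᵘ-homo-* (q ℚ.* q) dℚ) (ℚᵘP.*-congʳ (ℚP.toℚᵘ-homo-* q q))))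
                       (ℚᵘP.≃-reflexive (cong ℚ.toℚᵘ (trans q²d≡w (ι≡mkℚ w))))
    ... | ℚᵘ.*≡* eq rewrite ι≡mkℚ (+ d) = eq
    D≡1 : D ≡ 1
    D≡1 = squarefree-denominator sf ℤ.∣ r ∣ D (Coprime.recompute r⊥D) (divides ℤ.∣ w ∣ (begin
      ℤ.∣ r ∣ ℕ.* ℤ.∣ r ∣ ℕ.* d            ≡⟨ cong (ℕ._* d) (ℤP.abs-* r r) ⟨
      ℤ.∣ r ℤ.* r ∣ ℕ.* d                  ≡⟨ ℤP.abs-* (r ℤ.* r) (+ d) ⟨
      ℤ.∣ r ℤ.* r ℤ.* + d ∣                ≡⟨ cong ℤ.∣_∣ (ℤP.*-identityʳ (r ℤ.* r ℤ.* + d)) ⟨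
      ℤ.∣ r ℤ.* r ℤ.* + d ℤ.* + 1 ∣        ≡⟨ cong ℤ.∣_∣ cross-multiplied ⟩
      ℤ.∣ w ℤ.* + (D ℕ.* D ℕ.* 1) ∣        ≡⟨ ℤP.abs-* w _ ⟩
      ℤ.∣ w ∣ ℕ.* (D ℕ.* D ℕ.* 1)          ≡⟨ cong (ℤ.∣ w ∣ ℕ.*_) (ℕP.*-identityʳ (D ℕ.* D)) ⟩
      ℤ.∣ w ∣ ℕ.* (D ℕ.* D)                ∎))
      where open ≡-Reasoning

  IntegralCoordinates : ℚ → ℚ → Set
  IntegralCoordinates p q = Σ ℕ λ σ → σ ≤ 1 × (σ ≡ 1 → d % 4 ≡ 3) ×
    Σ ℤ λ a → Σ ℤ λ b → p ≡ ι a ℚ.+ ι (+ σ) ℚ.* ½ × q ≡ ι b ℚ.+ ι (+ σ) ℚ.* ½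

  integral⇒2q-integral : ∀ {p q} → InO (p , q) → IsInteger (q ℚ.+ q)
  integral⇒2q-integral {p} {q} ((s , 2p≡s) , (k , N≡k)) =
    q²d-integral⇒q-integral (q ℚ.+ q) (+ 4 ℤ.* k ℤ.- s ℤ.* s , (begin
      (q ℚ.+ q) ℚ.* (q ℚ.+ q) ℚ.* dℚ                                   ≡⟨ dn²≡4N-t² p q dℚ ⟩
      ι (+ 4) ℚ.* (p ℚ.* p ℚ.+ dℚ ℚ.* (q ℚ.* q)) ℚ.- (p ℚ.+ p) ℚ.* (p ℚ.+ p) ≡⟨ cong₂ (λ N t → ι (+ 4) ℚ.* N ℚ.- t ℚ.* t) N≡k 2p≡s ⟩
      ι (+ 4) ℚ.* ι k ℚ.- ι s ℚ.* ι s                                    ≡⟨ cong₂ ℚ._-_ (ι-homo-* (+ 4) k) (ι-homo-* s s) ⟨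
      ι (+ 4 ℤ.* k) ℚ.- ι (s ℤ.* s)                                      ≡⟨ cong (ι (+ 4 ℤ.* k) ℚ.+_) (ι-homo-neg (s ℤ.* s)) ⟨
      ι (+ 4 ℤ.* k) ℚ.+ ι (ℤ.- (s ℤ.* s))                                ≡⟨ ι-homo-+ (+ 4 ℤ.* k) (ℤ.- (s ℤ.* s)) ⟨
      ι (+ 4 ℤ.* k ℤ.- s ℤ.* s)                                          ∎))
    where
    open ≡-Reasoning
    dn²≡4N-t² : ∀ p q D → (q ℚ.+ q) ℚ.* (q ℚ.+ q) ℚ.* D
      ≡ ι (+ 4) ℚ.* (p ℚ.* p ℚ.+ D ℚ.* (q ℚ.* q)) ℚ.- (p ℚ.+ p) ℚ.* (p ℚ.+ p)
    dn²≡4N-t² = solve-∀ ℚ-ring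

  doubled-norm-equation : ∀ {p q s n k} → p ℚ.+ p ≡ ι s → q ℚ.+ q ≡ ι n → norm (p , q) ≡ ι k →
    s ℤ.* s ℤ.+ + d ℤ.* (n ℤ.* n) ≡ + 4 ℤ.* k
  doubled-norm-equation {p} {q} {s} {n} {k} 2p≡s 2q≡n N≡k = ι-injective (begin
    ι (s ℤ.* s ℤ.+ + d ℤ.* (n ℤ.* n))                  ≡⟨ ι-homo-+ (s ℤ.* s) (+ d ℤ.* (n ℤ.* n)) ⟩
    ι (s ℤ.* s) ℚ.+ ι (+ d ℤ.* (n ℤ.* n))              ≡⟨ cong₂ ℚ._+_ (ι-homo-* s s) (trans (ι-homo-* (+ d) (n ℤ.* n)) (cong (dℚ ℚ.*_) (ι-homo-* n n))) ⟩
    ι s ℚ.* ι s ℚ.+ dℚ ℚ.* (ι n ℚ.* ι n)               ≡⟨ cong₂ (λ t u → t ℚ.* t ℚ.+ dℚ ℚ.* (u ℚ.* u)) 2p≡s 2q≡n ⟨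
    (p ℚ.+ p) ℚ.* (p ℚ.+ p) ℚ.+ dℚ ℚ.* ((q ℚ.+ q) ℚ.* (q ℚ.+ q)) ≡⟨ 4N≡t²+dn² p q dℚ ⟩
    ι (+ 4) ℚ.* (p ℚ.* p ℚ.+ dℚ ℚ.* (q ℚ.* q))         ≡⟨ cong (ι (+ 4) ℚ.*_) N≡k ⟩
    ι (+ 4) ℚ.* ι k                                    ≡⟨ ι-homo-* (+ 4) k ⟨
    ι (+ 4 ℤ.* k)                                      ∎)
    where
    open ≡-Reasoning
    4N≡t²+dn² : ∀ p q D →
      (p ℚ.+ p) ℚ.* (p ℚ.+ p) ℚ.+ D ℚ.* ((q ℚ.+ q) ℚ.* (q ℚ.+ q)) ≡ ι (+ 4) ℚ.* (p ℚ.* p ℚ.+ D ℚ.* (q ℚ.* q))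
    4N≡t²+dn² = solve-∀ ℚ-ring

  integral⇒IntegralCoordinates : ∀ {p q} → InO (p , q) → IntegralCoordinates p q
  integral⇒IntegralCoordinates {p} {q} β-integral@((s , 2p≡s) , (k , N≡k)) =
    let n , 2q≡n = integral⇒2q-integral {p} {q} β-integral
        σ , σ≤1 , s-parity , n-parity , σ≡1⇒d≡3 =
          squarefree-parities sf ℤ.∣ s ∣ ℤ.∣ n ∣ ℤ.∣ k ∣
            (sum-of-squares-∣∣ d s n k (doubled-norm-equation {p} {q} {s} {n} {k} 2p≡s 2q≡n N≡k))
        a , s≡ = OfParity-∣∣⁻ σ≤1 s s-parity
        b , n≡ = OfParity-∣∣⁻ σ≤1 n n-parity
    in σ , σ≤1 , σ≡1⇒d≡3 , a , b ,
       halve {p} {σ} {a} (trans 2p≡s (cong ι s≡)) , halve {q} {σ} {b} (trans 2q≡n (cong ι n≡))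

  √-d-basis : d % 4 ≢ 3 → IsIntegralBasis d (0ℚ , 1ℚ)
  √-d-basis d≢3 = record
    { integral   = (+ 0 , refl) , (+ d , norm-√-d dℚ)
    ; spans      = λ {β} β-integral → from-coordinates (integral⇒IntegralCoordinates β-integral)
    ; irrational = λ ()
    }
    where
    norm-√-d : ∀ D → 0ℚ ℚ.* 0ℚ ℚ.+ D ℚ.* (1ℚ ℚ.* 1ℚ) ≡ D
    norm-√-d = solve-∀ ℚ-ring
    first-coordinate : ∀ A B → A ℚ.+ ι (+ 0) ℚ.* ½ ≡ A ℚ.+ B ℚ.* 0ℚ
    first-coordinate = solve-∀ ℚ-ring
    second-coordinate : ∀ B → B ℚ.+ ι (+ 0) ℚ.* ½ ≡ B ℚ.* 1ℚ
    second-coordinate = solve-∀ ℚ-ring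
    from-coordinates : ∀ {p q} → IntegralCoordinates p q → _∈ℤ+ℤ_ d (p , q) (0ℚ , 1ℚ)
    from-coordinates (0 , _ , _ , a , b , p≡ , q≡) = ι a , ι b , isInteger-ι d a , isInteger-ι d b ,
      cong₂ _,_ (trans p≡ (first-coordinate (ι a) (ι b))) (trans q≡ (second-coordinate (ι b)))
    from-coordinates (1 , _ , σ≡1⇒d≡3 , _) = ⊥-elim (d≢3 (σ≡1⇒d≡3 refl))
    from-coordinates (suc (suc _) , s≤s () , _)

  ω-basis : d % 4 ≡ 3 → IsIntegralBasis d (½ , ½)
  ω-basis d≡3 = record
    { integral   = (+ 1 , refl) , (+ (d ℕ./ 4) ℤ.+ + 1 , norm-ω)
    ; spans      = λ {β} β-integral → from-coordinates (integral⇒IntegralCoordinates β-integral)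
    ; irrational = λ ()
    }
    where
    d≡3+4q : dℚ ≡ ι (+ 3) ℚ.+ ι (+ (d ℕ./ 4)) ℚ.* ι (+ 4)
    d≡3+4q = begin
      ι (+ d)                                    ≡⟨ cong (λ m → ι (+ m)) (m≡m%n+[m/n]*n d 4) ⟩
      ι (+ (d % 4 ℕ.+ d ℕ./ 4 ℕ.* 4))              ≡⟨ cong (λ r → ι (+ (r ℕ.+ d ℕ./ 4 ℕ.* 4))) d≡3 ⟩
      ι (+ (3 ℕ.+ d ℕ./ 4 ℕ.* 4))                  ≡⟨ cong ι (trans (ℤP.pos-+ 3 (d ℕ./ 4 ℕ.* 4)) (cong (ℤ._+_ (+ 3)) (ℤP.pos-* (d ℕ./ 4) 4))) ⟩
      ι (+ 3 ℤ.+ + (d ℕ./ 4) ℤ.* + 4)              ≡⟨ ι-homo-+ (+ 3) (+ (d ℕ./ 4) ℤ.* + 4) ⟩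
      ι (+ 3) ℚ.+ ι (+ (d ℕ./ 4) ℤ.* + 4)          ≡⟨ cong (ι (+ 3) ℚ.+_) (ι-homo-* (+ (d ℕ./ 4)) (+ 4)) ⟩
      ι (+ 3) ℚ.+ ι (+ (d ℕ./ 4)) ℚ.* ι (+ 4)      ∎
      where open ≡-Reasoning
    norm-ω : ½ ℚ.* ½ ℚ.+ dℚ ℚ.* (½ ℚ.* ½) ≡ ι (+ (d ℕ./ 4) ℤ.+ + 1)
    norm-ω = begin
      ½ ℚ.* ½ ℚ.+ dℚ ℚ.* (½ ℚ.* ½)                                   ≡⟨ cong (λ D → ½ ℚ.* ½ ℚ.+ D ℚ.* (½ ℚ.* ½)) d≡3+4q ⟩
      ½ ℚ.* ½ ℚ.+ (ι (+ 3) ℚ.+ ι (+ (d ℕ./ 4)) ℚ.* ι (+ 4)) ℚ.* (½ ℚ.* ½) ≡⟨ quarter-of-1+d (ι (+ (d ℕ./ 4))) ⟩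
      ι (+ (d ℕ./ 4)) ℚ.+ ι (+ 1)                                       ≡⟨ ι-homo-+ (+ (d ℕ./ 4)) (+ 1) ⟨
      ι (+ (d ℕ./ 4) ℤ.+ + 1)                                           ∎
      where
      open ≡-Reasoning
      quarter-of-1+d : ∀ Q → ½ ℚ.* ½ ℚ.+ (ι (+ 3) ℚ.+ Q ℚ.* ι (+ 4)) ℚ.* (½ ℚ.* ½) ≡ Q ℚ.+ ι (+ 1)
      quarter-of-1+d = solve-∀ ℚ-ring
    first-coordinate : ∀ A B S → A ℚ.+ S ℚ.* ½ ≡ (A ℚ.- B) ℚ.+ (B ℚ.+ B ℚ.+ S) ℚ.* ½
    first-coordinate = solve-∀ ℚ-ring
    second-coordinate : ∀ B S → B ℚ.+ S ℚ.* ½ ≡ (B ℚ.+ B ℚ.+ S) ℚ.* ½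
    second-coordinate = solve-∀ ℚ-ring
    from-coordinates : ∀ {p q} → IntegralCoordinates p q → _∈ℤ+ℤ_ d (p , q) (½ , ½)
    from-coordinates (σ , _ , _ , a , b , p≡ , q≡) =
      ι a ℚ.- ι b , ι b ℚ.+ ι b ℚ.+ ι (+ σ) ,
      isInteger-+ d (isInteger-ι d a) (isInteger-neg d (isInteger-ι d b)) ,
      isInteger-+ d (isInteger-+ d (isInteger-ι d b) (isInteger-ι d b)) (isInteger-ι d (+ σ)) ,
      cong₂ _,_ (trans p≡ (first-coordinate (ι a) (ι b) (ι (+ σ)))) (trans q≡ (second-coordinate (ι b) (ι (+ σ))))

-- Counting ℤ ± ω by height

≤-by-difference : ∀ {a b c} → 0ℚ ℚ.≤ c → b ≡ a ℚ.+ c → a ℚ.≤ b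
≤-by-difference {a} 0≤c refl = subst (ℚ._≤ a ℚ.+ _) (ℚP.+-identityʳ a) (ℚP.+-monoʳ-≤ a 0≤c)

<-by-difference : ∀ {a b c} → 0ℚ ℚ.< c → b ≡ a ℚ.+ c → a ℚ.< b
<-by-difference {a} 0<c refl = subst (ℚ._< a ℚ.+ _) (ℚP.+-identityʳ a) (ℚP.+-monoʳ-< a 0<c)

difference-nonNeg : ∀ {a b} → a ℚ.≤ b → 0ℚ ℚ.≤ b ℚ.- a
difference-nonNeg {a} {b} a≤b = subst (ℚ._≤ b ℚ.- a) (ℚP.+-inverseʳ a) (ℚP.+-monoˡ-≤ (ℚ.- a) a≤b)

difference-pos : ∀ {a b} → a ℚ.< b → 0ℚ ℚ.< b ℚ.- a
difference-pos {a} {b} a<b = subst (ℚ._< b ℚ.- a) (ℚP.+-inverseʳ a) (ℚP.+-monoˡ-< (ℚ.- a) a<b)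

nonNeg-* : ∀ {a b} → 0ℚ ℚ.≤ a → 0ℚ ℚ.≤ b → 0ℚ ℚ.≤ a ℚ.* b
nonNeg-* {a} {b} 0≤a 0≤b = subst (ℚ._≤ a ℚ.* b) (ℚP.*-zeroʳ a) (ℚP.*-monoˡ-≤-nonNeg a {{ℚ.nonNegative 0≤a}} 0≤b)

square-mono-≤ : ∀ {a b} → 0ℚ ℚ.≤ a → a ℚ.≤ b → a ℚ.* a ℚ.≤ b ℚ.* b
square-mono-≤ {a} {b} 0≤a a≤b = ℚP.≤-trans (ℚP.*-monoˡ-≤-nonNeg a {{ℚ.nonNegative 0≤a}} a≤b)
                                           (ℚP.*-monoʳ-≤-nonNeg b {{ℚ.nonNegative (ℚP.≤-trans 0≤a a≤b)}} a≤b)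

square-mono-< : ∀ {a b} → 0ℚ ℚ.≤ a → a ℚ.< b → a ℚ.* a ℚ.< b ℚ.* b
square-mono-< {a} {b} 0≤a a<b = ℚP.≤-<-trans (ℚP.*-monoˡ-≤-nonNeg a {{ℚ.nonNegative 0≤a}} (ℚP.<⇒≤ a<b))
                                              (ℚP.*-monoˡ-<-pos b {{ℚ.positive (ℚP.≤-<-trans 0≤a a<b)}} a<b)

square-cancel-≤ : ∀ {a b} → 0ℚ ℚ.≤ b → a ℚ.* a ℚ.≤ b ℚ.* b → a ℚ.≤ b
square-cancel-≤ {a} {b} 0≤b a²≤b² = ℚP.≮⇒≥ λ b<a → ℚP.<-irrefl refl (ℚP.<-≤-trans (square-mono-< 0≤b b<a) a²≤b²)

∣∣≤ : ∀ {q C} → q ℚ.≤ C → ℚ.- q ℚ.≤ C → ℚ.∣ q ∣ ℚ.≤ C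
∣∣≤ {q} q≤C -q≤C with ℚP.∣p∣≡p∨∣p∣≡-p q
... | inj₁ ∣q∣≡q  = subst (ℚ._≤ _) (sym ∣q∣≡q) q≤C
... | inj₂ ∣q∣≡-q = subst (ℚ._≤ _) (sym ∣q∣≡-q) -q≤C

-- X ≤ N by the first inequality, and N < X + 3/2 since otherwise (X + 1)² + c ≤ (N − ½)² + c ≤ N².
count-bound : ∀ {X N c} → 0ℚ ℚ.≤ X → 0ℚ ℚ.≤ c → c ℚ.+ 1ℚ ℚ.≤ N →
  X ℚ.* X ℚ.+ c ℚ.≤ N ℚ.* N → ¬ ((X ℚ.+ 1ℚ) ℚ.* (X ℚ.+ 1ℚ) ℚ.+ c ℚ.≤ N ℚ.* N) →
  ℚ.∣ (ι (+ 2) ℚ.+ ι (+ 4) ℚ.* X) ℚ.- ι (+ 4) ℚ.* N ∣ ℚ.≤ ι (+ 4)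
count-bound {X} {N} {c} 0≤X 0≤c c+1≤N X²+c≤N² ¬fits = ∣∣≤
  (≤-by-difference (ℚP.+-mono-≤ 0≤2 (nonNeg-* 0≤4 (difference-nonNeg X≤N))) (upper X N))
  (ℚP.<⇒≤ (<-by-difference 0<4·gap (lower X N)))
  where
  0≤1 : 0ℚ ℚ.≤ 1ℚ
  0≤1 = ℚP.≤ᵇ⇒≤ _
  0≤2 : 0ℚ ℚ.≤ ι (+ 2)
  0≤2 = ℚP.≤ᵇ⇒≤ _
  0≤4 : 0ℚ ℚ.≤ ι (+ 4)
  0≤4 = ℚP.≤ᵇ⇒≤ _
  0≤¾ : 0ℚ ℚ.≤ ½ ℚ.+ ½ ℚ.* ½
  0≤¾ = ℚP.≤ᵇ⇒≤ _
  0≤N : 0ℚ ℚ.≤ N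
  0≤N = ℚP.≤-trans (ℚP.+-mono-≤ 0≤c 0≤1) c+1≤N
  X≤N : X ℚ.≤ N
  X≤N = square-cancel-≤ 0≤N (ℚP.≤-trans (≤-by-difference 0≤c refl) X²+c≤N²)
  N<X+3/2 : N ℚ.< X ℚ.+ 1ℚ ℚ.+ ½
  N<X+3/2 = ℚP.≰⇒> λ X+3/2≤N → ¬fits (ℚP.≤-trans
    (ℚP.+-monoˡ-≤ c (square-mono-≤ (ℚP.+-mono-≤ 0≤X 0≤1) (≤-by-difference (difference-nonNeg X+3/2≤N) (shift X N))))
    (≤-by-difference (ℚP.+-mono-≤ (difference-nonNeg c+1≤N) 0≤¾) (square N c)))
    where
    shift : ∀ X N → N ℚ.- ½ ≡ (X ℚ.+ 1ℚ) ℚ.+ (N ℚ.- (X ℚ.+ 1ℚ ℚ.+ ½))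
    shift = solve-∀ ℚ-ring
    square : ∀ N c → N ℚ.* N ≡ ((N ℚ.- ½) ℚ.* (N ℚ.- ½) ℚ.+ c) ℚ.+ ((N ℚ.- (c ℚ.+ 1ℚ)) ℚ.+ (½ ℚ.+ ½ ℚ.* ½))
    square = solve-∀ ℚ-ring
  0<4·gap : 0ℚ ℚ.< ι (+ 4) ℚ.* ((X ℚ.+ 1ℚ ℚ.+ ½) ℚ.- N)
  0<4·gap = subst (ℚ._< ι (+ 4) ℚ.* ((X ℚ.+ 1ℚ ℚ.+ ½) ℚ.- N)) (ℚP.*-zeroʳ (ι (+ 4)))
                  (ℚP.*-monoʳ-<-pos (ι (+ 4)) (difference-pos N<X+3/2))
  upper : ∀ X N → ι (+ 4) ≡ ((ι (+ 2) ℚ.+ ι (+ 4) ℚ.* X) ℚ.- ι (+ 4) ℚ.* N) ℚ.+ (ι (+ 2) ℚ.+ ι (+ 4) ℚ.* (N ℚ.- X))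
  upper = solve-∀ ℚ-ring
  lower : ∀ X N → ι (+ 4) ≡ ℚ.- ((ι (+ 2) ℚ.+ ι (+ 4) ℚ.* X) ℚ.- ι (+ 4) ℚ.* N) ℚ.+ ι (+ 4) ℚ.* ((X ℚ.+ 1ℚ ℚ.+ ½) ℚ.- N)
  lower = solve-∀ ℚ-ring

half : ℤ → ℚ
half m = ι m ℚ.* ½

half+half : ∀ m → half m ℚ.+ half m ≡ ι m
half+half m = halves (ι m)
  where
  halves : ∀ M → M ℚ.* ½ ℚ.+ M ℚ.* ½ ≡ M
  halves = solve-∀ ℚ-ring

HeightCount≈4N : ℕ → (K → Set) → Set
HeightCount≈4N d P = Σ ℚ λ C → Σ ℚ λ N₀ → (N : ℚ) → N₀ ℚ.≤ N →
  Σ (List K) λ L → Unique L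
    × (∀ α → (α ∈ L) ⇔ (P α × QuadField.HeightLe d α N))
    × (ℚ.∣ ι (+ length L) ℚ.- (+ 4 / 1) ℚ.* N ∣ ℚ.≤ C)

HeightCount≈4N-⇔ : ∀ {d P Q} → (∀ α → P α ⇔ Q α) → HeightCount≈4N d P → HeightCount≈4N d Q
HeightCount≈4N-⇔ P⇔Q (C , N₀ , count) = C , N₀ , λ N N₀≤N →
  let L , unique , ∈L⇔ , bound = count N N₀≤N
  in L , unique , (λ α → mk⇔ (λ α∈L → let Pα , h = Equivalence.to (∈L⇔ α) α∈L in Equivalence.to (P⇔Q α) Pα , h)
                              (λ (Qα , h) → Equivalence.from (∈L⇔ α) (Equivalence.from (P⇔Q α) Qα , h))) ,
     bound

module Counting (d : ℕ) {e : ℕ} (e≤1 : e ≤ 1) {y : ℚ} (y∈ : y ≡ 1ℚ ⊎ y ≡ ½) where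
  open QuadField d

  ω : K
  ω = half (+ e) , y

  ParityPoint : K → Set
  ParityPoint α = Σ ℤ λ m → OfParity e ℤ.∣ m ∣ × (α ≡ (half m , y) ⊎ α ≡ (half m , ℚ.- y))

  ∈ℤ±⇒ParityPoint : ∀ {α} → _∈ℤ±_ d α ω → ParityPoint α
  ∈ℤ±⇒ParityPoint (_ , (c , refl) , inj₁ refl) =
    + e ℤ.+ + 2 ℤ.* c , OfParity-∣∣⁺ e≤1 c ,
    inj₁ (cong (_, y) (sym (halve {half m} {e} {c} (half+half m))))
    where m = + e ℤ.+ + 2 ℤ.* c
  ∈ℤ±⇒ParityPoint (_ , (c , refl) , inj₂ refl) =
    + e ℤ.+ + 2 ℤ.* c′ , OfParity-∣∣⁺ e≤1 c′ ,
    inj₂ (cong (_, ℚ.- y) (sym (trans (halve {half m} {e} {c′} (half+half m)) shift)))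
    where
    c′ = c ℤ.- + e
    m = + e ℤ.+ + 2 ℤ.* c′
    shift-by-e : ∀ C E → (C ℚ.+ ℚ.- E) ℚ.+ E ℚ.* ½ ≡ C ℚ.- E ℚ.* ½
    shift-by-e = solve-∀ ℚ-ring
    shift : ι c′ ℚ.+ half (+ e) ≡ ι c ℚ.- half (+ e)
    shift = trans (cong (ℚ._+ half (+ e)) (trans (ι-homo-+ c (ℤ.- + e)) (cong (ι c ℚ.+_) (ι-homo-neg (+ e)))))
                  (shift-by-e (ι c) (ι (+ e)))

  ParityPoint⇒∈ℤ± : ∀ {α} → ParityPoint α → _∈ℤ±_ d α ω
  ParityPoint⇒∈ℤ± (m , parity , sign) =
    let a , m≡ = OfParity-∣∣⁻ e≤1 m parity
        half-m≡ = halve {half m} {e} {a} (trans (half+half m) (cong ι m≡))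
    in from-sign a half-m≡ sign
    where
    shift-by-e : ∀ A E → A ℚ.+ E ℚ.* ½ ≡ (A ℚ.+ E) ℚ.- E ℚ.* ½
    shift-by-e = solve-∀ ℚ-ring
    from-sign : ∀ {α} a → half m ≡ ι a ℚ.+ half (+ e) → α ≡ (half m , y) ⊎ α ≡ (half m , ℚ.- y) → _∈ℤ±_ d α ω
    from-sign a half-m≡ (inj₁ refl) = ι a , isInteger-ι d a , inj₁ (cong (_, y) half-m≡)
    from-sign a half-m≡ (inj₂ refl) = ι a ℚ.+ ι (+ e) , isInteger-+ d (isInteger-ι d a) (isInteger-ι d (+ e)) ,
      inj₂ (cong (_, ℚ.- y) (trans half-m≡ (shift-by-e (ι a) (ι (+ e)))))

  normAt : ℕ → ℚ
  normAt k = norm (half (+ k) , y)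

  private
    one-or-half : ∀ {y} → y ≡ 1ℚ ⊎ y ≡ ½ → 0ℚ ℚ.≤ y ℚ.* y × y ℚ.* y ℚ.≤ 1ℚ × y ≢ ℚ.- y
    one-or-half (inj₁ refl) = ℚP.≤ᵇ⇒≤ _ , ℚP.≤ᵇ⇒≤ _ , λ ()
    one-or-half (inj₂ refl) = ℚP.≤ᵇ⇒≤ _ , ℚP.≤ᵇ⇒≤ _ , λ ()

  0≤y² : 0ℚ ℚ.≤ y ℚ.* y
  0≤y² = proj₁ (one-or-half y∈)

  y²≤1 : y ℚ.* y ℚ.≤ 1ℚ
  y²≤1 = proj₁ (proj₂ (one-or-half y∈))

  y≢-y : y ≢ ℚ.- y
  y≢-y = proj₂ (proj₂ (one-or-half y∈))

  half-nonNeg : ∀ k → 0ℚ ℚ.≤ half (+ k)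
  half-nonNeg k = nonNeg-* (ι-mono-≤ {+ 0} {+ k} (ℤ.+≤+ z≤n)) 0≤½
    where
    0≤½ : 0ℚ ℚ.≤ ½
    0≤½ = ℚP.≤ᵇ⇒≤ _

  half-mono-≤ : ∀ {k k′} → k ≤ k′ → half (+ k) ℚ.≤ half (+ k′)
  half-mono-≤ {k} {k′} k≤k′ = ℚP.*-monoʳ-≤-nonNeg ½ (ι-mono-≤ {+ k} {+ k′} (ℤ.+≤+ k≤k′))

  normAt-mono-≤ : ∀ {k k′} → k ≤ k′ → normAt k ℚ.≤ normAt k′
  normAt-mono-≤ {k} k≤k′ = ℚP.+-monoˡ-≤ (dℚ ℚ.* (y ℚ.* y)) (square-mono-≤ (half-nonNeg k) (half-mono-≤ k≤k′))

  half-square : ∀ m → half m ℚ.* half m ≡ half (+ ℤ.∣ m ∣) ℚ.* half (+ ℤ.∣ m ∣)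
  half-square (+ n)    = refl
  half-square -[1+ n ] = trans (cong (λ A → (A ℚ.* ½) ℚ.* (A ℚ.* ½)) (ι-homo-neg (+ suc n))) (neg-square (ι (+ suc n)))
    where
    neg-square : ∀ A → (ℚ.- A ℚ.* ½) ℚ.* (ℚ.- A ℚ.* ½) ≡ (A ℚ.* ½) ℚ.* (A ℚ.* ½)
    neg-square = solve-∀ ℚ-ring

  norm-half : ∀ m {y′} → y′ ℚ.* y′ ≡ y ℚ.* y → norm (half m , y′) ≡ normAt ℤ.∣ m ∣
  norm-half m y′²≡y² = cong₂ (λ a b → a ℚ.+ dℚ ℚ.* b) (half-square m) y′²≡y²

  -y²≡y² : ℚ.- y ℚ.* ℚ.- y ≡ y ℚ.* y
  -y²≡y² = solve (y ∷ []) ℚ-ring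

  half-double : ∀ k → half (+ (2 ℕ.* k)) ≡ ι (+ k)
  half-double k = trans (cong (ℚ._* ½) (trans (cong ι (ℤP.pos-* 2 k)) (ι-homo-* (+ 2) (+ k)))) (cancel-2 (ι (+ k)))
    where
    cancel-2 : ∀ A → (ι (+ 2) ℚ.* A) ℚ.* ½ ≡ A
    cancel-2 = solve-∀ ℚ-ring

  half-step : ∀ b → half (+ (e ℕ.+ 2 ℕ.* suc b)) ≡ half (+ (e ℕ.+ 2 ℕ.* b)) ℚ.+ 1ℚ
  half-step b = begin
    half (+ (e ℕ.+ 2 ℕ.* suc b))             ≡⟨ cong (λ k → half (+ k)) (shift e b) ⟩
    half (+ (e ℕ.+ 2 ℕ.* b ℕ.+ 2))           ≡⟨ cong (ℚ._* ½) (trans (cong ι (ℤP.pos-+ (e ℕ.+ 2 ℕ.* b) 2)) (ι-homo-+ (+ (e ℕ.+ 2 ℕ.* b)) (+ 2))) ⟩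
    (ι (+ (e ℕ.+ 2 ℕ.* b)) ℚ.+ ι (+ 2)) ℚ.* ½ ≡⟨ add-2 (ι (+ (e ℕ.+ 2 ℕ.* b))) ⟩
    half (+ (e ℕ.+ 2 ℕ.* b)) ℚ.+ 1ℚ          ∎
    where
    open ≡-Reasoning
    shift : ∀ e b → e ℕ.+ 2 ℕ.* suc b ≡ e ℕ.+ 2 ℕ.* b ℕ.+ 2
    shift = ℕ-Solver.solve-∀
    add-2 : ∀ A → (A ℚ.+ ι (+ 2)) ℚ.* ½ ≡ A ℚ.* ½ ℚ.+ 1ℚ
    add-2 = solve-∀ ℚ-ring

  half-injective : ∀ {m m′} → half m ≡ half m′ → m ≡ m′
  half-injective {m} {m′} eq = ι-injective (trans (sym (half+half m)) (trans (cong (λ h → h ℚ.+ h) eq) (half+half m′)))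

  module _ (N : ℚ) (d+1≤N : dℚ ℚ.+ 1ℚ ℚ.≤ N) where
    private
      c = dℚ ℚ.* (y ℚ.* y)

    0≤d : 0ℚ ℚ.≤ dℚ
    0≤d = ι-mono-≤ {+ 0} {+ d} (ℤ.+≤+ z≤n)

    0≤c : 0ℚ ℚ.≤ c
    0≤c = nonNeg-* 0≤d 0≤y²

    c≤d : c ℚ.≤ dℚ
    c≤d = subst (c ℚ.≤_) (ℚP.*-identityʳ dℚ) (ℚP.*-monoˡ-≤-nonNeg dℚ {{ℚ.nonNegative 0≤d}} y²≤1)

    1≤N : 1ℚ ℚ.≤ N
    1≤N = ℚP.≤-trans (≤-by-difference 0≤d (ℚP.+-comm dℚ 1ℚ)) d+1≤N

    0≤N : 0ℚ ℚ.≤ N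
    0≤N = ℚP.≤-trans (ℚP.≤ᵇ⇒≤ _) 1≤N

    N≤N² : N ℚ.≤ N ℚ.* N
    N≤N² = subst (ℚ._≤ N ℚ.* N) (ℚP.*-identityʳ N) (ℚP.*-monoˡ-≤-nonNeg N {{ℚ.nonNegative 0≤N}} 1≤N)

    Fits : ℕ → Set
    Fits b = normAt (e ℕ.+ 2 ℕ.* b) ℚ.≤ N ℚ.* N

    fits-0 : Fits 0
    fits-0 = subst (λ k → normAt k ℚ.≤ N ℚ.* N) (sym (ℕP.+-identityʳ e))
      (ℚP.≤-trans (ℚP.+-mono-≤ (half-e²≤1 e≤1) c≤d) (ℚP.≤-trans (ℚP.≤-reflexive (ℚP.+-comm 1ℚ dℚ)) (ℚP.≤-trans d+1≤N N≤N²)))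
      where
      half-e²≤1 : ∀ {e} → e ≤ 1 → half (+ e) ℚ.* half (+ e) ℚ.≤ 1ℚ
      half-e²≤1 z≤n       = ℚP.≤ᵇ⇒≤ _
      half-e²≤1 (s≤s z≤n) = ℚP.≤ᵇ⇒≤ _

    ¬fits-beyond-N : ¬ Fits (suc ℤ.∣ ℚ.↥ N ∣)
    ¬fits-beyond-N N²≥normAt =
      ℚP.<-irrefl refl (ℚP.<-≤-trans (square-mono-< 0≤N N<H) (ℚP.≤-trans (≤-by-difference 0≤c refl) N²≥normAt))
      where
      M = ℤ.∣ ℚ.↥ N ∣
      H = half (+ (e ℕ.+ 2 ℕ.* suc M))
      N<H : N ℚ.< H
      N<H = begin-strict
        N                          ≤⟨ p≤∣↥p∣ N ⟩
        ι (+ M)                    <⟨ <-by-difference (ℚP.positive⁻¹ 1ℚ) (trans (ι-homo-+ (+ 1) (+ M)) (ℚP.+-comm 1ℚ (ι (+ M)))) ⟩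
        ι (+ suc M)                ≡⟨ half-double (suc M) ⟨
        half (+ (2 ℕ.* suc M))     ≤⟨ half-mono-≤ (ℕP.m≤n+m (2 ℕ.* suc M) e) ⟩
        H                          ∎
        where open ℚP.≤-Reasoning

    last-fit : Σ ℕ λ b → Fits b × ¬ Fits (suc b)
    last-fit = boundary (λ b → normAt (e ℕ.+ 2 ℕ.* b) ℚP.≤? N ℚ.* N) fits-0 (suc ℤ.∣ ℚ.↥ N ∣) ¬fits-beyond-N

    module Enumeration (b₀ : ℕ) (fits-b₀ : Fits b₀) (¬fits-b₀+1 : ¬ Fits (suc b₀)) where

      fits⇒≤b₀ : ∀ {i} → Fits i → i ≤ b₀
      fits⇒≤b₀ fits-i = ℕP.≮⇒≥ λ b₀<i → ¬fits-b₀+1 (ℚP.≤-trans (normAt-mono-≤ (ℕP.+-monoʳ-≤ e (ℕP.*-monoʳ-≤ 2 b₀<i))) fits-i)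

      R : List ℤ
      R = parityInterval e b₀

      point⁺ point⁻ : ℤ → K
      point⁺ m = half m , y
      point⁻ m = half m , ℚ.- y

      L : List K
      L = map point⁺ R ++ map point⁻ R

      L-unique : Unique L
      L-unique = Unique.++⁺ (Unique.map⁺ (λ eq → half-injective (cong proj₁ eq)) (parityInterval-unique e b₀))
                            (Unique.map⁺ (λ eq → half-injective (cong proj₁ eq)) (parityInterval-unique e b₀))
                            disjoint
        where
        disjoint : ∀ {α} → ¬ (α ∈ map point⁺ R × α ∈ map point⁻ R)
        disjoint (α∈⁺ , α∈⁻) =
          let _ , _ , α≡⁺ = ∈-map⁻ point⁺ α∈⁺
              _ , _ , α≡⁻ = ∈-map⁻ point⁻ α∈⁻
          in y≢-y (cong proj₂ (trans (sym α≡⁺) α≡⁻))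

      length-L : length L ≡ suc (e ℕ.+ 2 ℕ.* b₀) ℕ.+ suc (e ℕ.+ 2 ℕ.* b₀)
      length-L = trans (List.length-++ (map point⁺ R))
                       (cong₂ ℕ._+_ (trans (List.length-map point⁺ R) (length-parityInterval e≤1 b₀))
                                    (trans (List.length-map point⁻ R) (length-parityInterval e≤1 b₀)))

      norm-point : ∀ {α m} → α ≡ point⁺ m ⊎ α ≡ point⁻ m → norm α ≡ normAt ℤ.∣ m ∣
      norm-point {m = m} (inj₁ refl) = norm-half m {y} refl
      norm-point {m = m} (inj₂ refl) = norm-half m {ℚ.- y} -y²≡y²

      point⇒∈ℤ±×HeightLe : ∀ {α m} → m ∈ R → α ≡ point⁺ m ⊎ α ≡ point⁻ m → _∈ℤ±_ d α ω × HeightLe α N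
      point⇒∈ℤ±×HeightLe {α} {m} m∈R sign =
        let i , i≤b₀ , ∣m∣≡ = ∈-parityInterval⁻ e b₀ m∈R
        in ParityPoint⇒∈ℤ± (m , (i , ∣m∣≡) , sign) , 0≤N ,
           ℚP.≤-trans (ℚP.≤-reflexive (trans (norm-point {α} {m} sign) (cong normAt ∣m∣≡)))
                      (ℚP.≤-trans (normAt-mono-≤ {e ℕ.+ 2 ℕ.* i} (ℕP.+-monoʳ-≤ e (ℕP.*-monoʳ-≤ 2 i≤b₀))) fits-b₀)

      ∈L⇒ : ∀ {α} → α ∈ L → _∈ℤ±_ d α ω × HeightLe α N
      ∈L⇒ α∈L = [ (λ α∈⁺ → let m , m∈R , α≡ = ∈-map⁻ point⁺ α∈⁺ in point⇒∈ℤ±×HeightLe m∈R (inj₁ α≡))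
                , (λ α∈⁻ → let m , m∈R , α≡ = ∈-map⁻ point⁻ α∈⁻ in point⇒∈ℤ±×HeightLe m∈R (inj₂ α≡)) ]′
                (∈-++⁻ (map point⁺ R) α∈L)

      ∈L⇐ : ∀ {α} → _∈ℤ±_ d α ω × HeightLe α N → α ∈ L
      ∈L⇐ (α∈ , _ , norm≤N²) =
        let m , (i , ∣m∣≡) , sign = ∈ℤ±⇒ParityPoint α∈
            fits-i = subst (λ k → normAt k ℚ.≤ N ℚ.* N) ∣m∣≡ (subst (ℚ._≤ N ℚ.* N) (norm-point {m = m} sign) norm≤N²)
        in from-sign m (∈-parityInterval⁺ m (fits⇒≤b₀ {i} fits-i) ∣m∣≡) sign
        where
        from-sign : ∀ {α} m → m ∈ R → α ≡ point⁺ m ⊎ α ≡ point⁻ m → α ∈ L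
        from-sign m m∈R (inj₁ refl) = ∈-++⁺ˡ (∈-map⁺ point⁺ m∈R)
        from-sign m m∈R (inj₂ refl) = ∈-++⁺ʳ (map point⁺ R) (∈-map⁺ point⁻ m∈R)

      length-bound : ℚ.∣ ι (+ length L) ℚ.- (+ 4 / 1) ℚ.* N ∣ ℚ.≤ ι (+ 4)
      length-bound = subst (λ l → ℚ.∣ l ℚ.- ι (+ 4) ℚ.* N ∣ ℚ.≤ ι (+ 4)) (sym length≡)
        (count-bound (half-nonNeg B) 0≤c (ℚP.≤-trans (ℚP.+-monoˡ-≤ 1ℚ c≤d) d+1≤N) fits-b₀
          (λ fits → ¬fits-b₀+1 (subst (λ h → h ℚ.* h ℚ.+ c ℚ.≤ N ℚ.* N) (sym (half-step b₀)) fits)))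
        where
        B = e ℕ.+ 2 ℕ.* b₀
        2B≡4·B/2 : ∀ A → ι (+ 2) ℚ.+ (A ℚ.+ A) ≡ ι (+ 2) ℚ.+ ι (+ 4) ℚ.* (A ℚ.* ½)
        2B≡4·B/2 = solve-∀ ℚ-ring
        double-suc : ∀ B → suc B ℕ.+ suc B ≡ 2 ℕ.+ (B ℕ.+ B)
        double-suc = ℕ-Solver.solve-∀
        length≡ : ι (+ length L) ≡ ι (+ 2) ℚ.+ ι (+ 4) ℚ.* half (+ B)
        length≡ = begin
          ι (+ length L)                     ≡⟨ cong (λ l → ι (+ l)) (trans length-L (double-suc B)) ⟩
          ι (+ 2 ℤ.+ (+ B ℤ.+ + B))          ≡⟨ ι-homo-+ (+ 2) (+ B ℤ.+ + B) ⟩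
          ι (+ 2) ℚ.+ ι (+ B ℤ.+ + B)        ≡⟨ cong (ι (+ 2) ℚ.+_) (ι-homo-+ (+ B) (+ B)) ⟩
          ι (+ 2) ℚ.+ (ι (+ B) ℚ.+ ι (+ B))  ≡⟨ 2B≡4·B/2 (ι (+ B)) ⟩
          ι (+ 2) ℚ.+ ι (+ 4) ℚ.* half (+ B) ∎
          where open ≡-Reasoning

  ∈ℤ±ω-count : HeightCount≈4N d (λ α → _∈ℤ±_ d α ω)
  ∈ℤ±ω-count = ι (+ 4) , dℚ ℚ.+ 1ℚ , λ N d+1≤N →
    let b₀ , fits-b₀ , ¬fits-b₀+1 = last-fit N d+1≤N
        open Enumeration N d+1≤N b₀ fits-b₀ ¬fits-b₀+1
    in L , L-unique , (λ α → mk⇔ ∈L⇒ ∈L⇐) , length-bound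

weil-count : ∀ {d a b} → IsIntegralBasis d (a , b) →
  HeightCount≈4N d (λ α → _∈ℤ±_ d α (a , b)) → HeightCount≈4N d (QuadField.IsWeilGenerator d)
weil-count {d} basis = HeightCount≈4N-⇔ {d} (λ α → ⇔.sym (IsWeilGenerator⇔∈ℤ± d basis α))

proposition5p2 : (d : ℕ) → d ≥ 1 → SquareFree d →
    let open QuadField d in
    Σ ℚ λ C → Σ ℚ λ N₀ → (N : ℚ) → N₀ ℚ.≤ N →
    Σ (List K) λ L →
    Unique L
    × (∀ α → (α ∈ L) ⇔ (IsWeilGenerator α × HeightLe α N))
    × (ℚ.∣ ℤ→ℚ (+ length L) ℚ.- (+ 4 / 1) ℚ.* N ∣ ℚ.≤ C)
proposition5p2 d _ sf with d % 4 ℕP.≟ 3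
... | yes d≡3 = weil-count (ω-basis sf d≡3) (Counting.∈ℤ±ω-count d (s≤s z≤n) (inj₂ refl))
... | no d≢3  = weil-count (√-d-basis sf d≢3) (Counting.∈ℤ±ω-count d z≤n (inj₁ refl))
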